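{- Let $k\ge 1$ and let $F$ be a finite set of polynomials in $\mathbb{Z}[x_1,\dots,x_k]$. For every prime $p$ and every integer $a\ge 1$, \[ \phi_{F}(p^a)=\sum_{J\subseteq F}(-1)^{|J|+1}\varphi_J(p^a) \qquad\text{and}\qquad \varphi_F(p^a)=\sum_{J\subseteq F}(-1)^{|J|+1}\phi_J(p^{a}). \]
   Context: For a finite set $G=\{g_1,\dots,g_m\}\neq\varnothing$ of polynomials in $\mathbb{Z}[x_1,\dots,x_k]$ and an integer $n\ge 1$, define $\varphi_G(n)=|\{(a_1,\dots,a_k)\in\mathbb{Z}_n^k:\gcd(g_1(a_1,\dots,a_k),\dots,g_m(a_1,\dots,a_k),n)=1\}|$ and $\phi_G(n)=|\{(a_1,\dots,a_k)\in\mathbb{Z}_n^k:\gcd(g_i(a_1,\dots,a_k),n)=1\text{ for every }i=1,\dots,m\}|$. By convention $\varphi_\varnothing(n)=\phi_\varnothing(n)=0$ (so the $J=\varnothing$ term of each sum contributes $0$), and $\varphi_G(1)=\phi_G(1)=1$ for $G\neq\varnothing$. -}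

module Defs where

open import Data.Nat as ℕ using (ℕ; zero; suc)
open import Data.Nat.GCD using (gcd)
open import Data.Integer as ℤ using (ℤ; +_; -[1+_]; ∣_∣)
open import Data.Fin using (Fin; toℕ)
open import Data.Vec using (Vec; []; _∷_; lookup)
open import Data.List as List using (List; []; _∷_; map; concatMap; length; foldr)
open import Data.Bool using (if_then_else_)
open import Relation.Nullary.Decidable using (does)

-- Polynomials in ℤ[x₁,…,x_k], represented as (syntactic) polynomial expressions
-- in the variables x₀ … x_{k-1}. Every polynomial with integer coefficients is
-- representable; only the evaluation ⟦_⟧ is used below.
data Poly (k : ℕ) : Set where
  const : ℤ → Poly k
  var   : Fin k → Poly k
  _⊕_   : Poly k → Poly k → Poly k
  _⊗_   : Poly k → Poly k → Poly k

⟦_⟧ : ∀ {k} → Poly k → Vec ℤ k → ℤ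
⟦ const c ⟧ x = c
⟦ var i   ⟧ x = lookup x i
⟦ f ⊕ g   ⟧ x = ⟦ f ⟧ x ℤ.+ ⟦ g ⟧ x
⟦ f ⊗ g   ⟧ x = ⟦ f ⟧ x ℤ.* ⟦ g ⟧ x

-- All tuples (a₁,…,a_k) ∈ ℤ_n^k, residues represented by 0,…,n-1.
tuples : (k n : ℕ) → List (Vec (Fin n) k)
tuples zero    n = [] ∷ []
tuples (suc k) n = concatMap (λ a → map (a ∷_) (tuples k n)) (List.allFin n)

toℤVec : ∀ {k n} → Vec (Fin n) k → Vec ℤ k
toℤVec []      = []
toℤVec (a ∷ v) = + toℕ a ∷ toℤVec v

countB : ∀ {A : Set} → (A → Data.Bool.Bool) → List A → ℕ
countB P []       = 0
countB P (x ∷ xs) = if P x then suc (countB P xs) else countB P xs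

gcdAll : ∀ {k} → List (Poly k) → Vec ℤ k → ℕ → ℕ
gcdAll G x n = foldr (λ g r → gcd ∣ ⟦ g ⟧ x ∣ r) n G

allCoprime : ∀ {k} → List (Poly k) → Vec ℤ k → ℕ → Data.Bool.Bool
allCoprime []      x n = Data.Bool.true
allCoprime (g ∷ G) x n = does (gcd ∣ ⟦ g ⟧ x ∣ n ℕ.≟ 1) Data.Bool.∧ allCoprime G x n

varphi : ∀ {k} → List (Poly k) → ℕ → ℕ
varphi {k} []      n = 0
varphi {k} (g ∷ G) n =
  countB (λ a → does (gcdAll (g ∷ G) (toℤVec a) n ℕ.≟ 1)) (tuples k n)

phi : ∀ {k} → List (Poly k) → ℕ → ℕ
phi {k} []      n = 0
phi {k} (g ∷ G) n =
  countB (λ a → allCoprime (g ∷ G) (toℤVec a) n) (tuples k n)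

-- All sub-families J ⊆ F (subsequences, i.e. subsets of the index positions of F).
subfamilies : ∀ {A : Set} → List A → List (List A)
subfamilies []       = [] ∷ []
subfamilies (x ∷ xs) = subfamilies xs List.++ map (x ∷_) (subfamilies xs)

signSucc : ℕ → ℤ
signSucc zero    = ℤ.- (+ 1)
signSucc (suc j) = ℤ.- signSucc j

altSum : ∀ {k} → (List (Poly k) → ℕ) → List (Poly k) → ℤ
altSum h F = foldr ℤ._+_ (+ 0) (map (λ J → signSucc (length J) ℤ.* + h J) (subfamilies F))

{-# OPTIONS --safe #-}
module Submission where

-- For n = p^a a divisor d of n is 1 exactly when p ∤ d. Hence gcd(g(x), n) = 1 iff
-- p ∤ g(x), and gcd(g₁(x), …, g_m(x), n) = 1 iff p ∤ gᵢ(x) for some i. So with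
-- bᵢ(x) the Boolean "p ∤ gᵢ(x)", φ_J(p^a) counts the points x at which some bᵢ,
-- i ∈ J, holds, and ϕ_J(p^a) those at which J ≠ ∅ and all bᵢ, i ∈ J, hold. Summing
-- over x, both identities reduce to the Boolean inclusion–exclusion identities
--   Σ_{J⊆F} (-1)^{|J|+1} [∃ i∈J. bᵢ]          = [F ≠ ∅ ∧ ∀ i∈F. bᵢ],
--   Σ_{J⊆F} (-1)^{|J|+1} [J ≠ ∅ ∧ ∀ i∈J. bᵢ] = [∃ i∈F. bᵢ],
-- proved by induction on F, splitting the subfamilies of g ∷ F into those
-- without g and those with g.

open import Defs
open import Data.Bool using (Bool; true; false; not; _∧_; _∨_; if_then_else_)
open import Data.Bool.ListAction using (any; all)
open import Data.Bool.Properties using (∨-identityʳ)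
open import Data.Fin using (Fin)
open import Data.Integer using (ℤ; +_; _+_; _*_; -_; _-_; ∣_∣)
open import Data.Integer.Properties
  using (+-identityˡ; +-identityʳ; +-inverseʳ; +-assoc; neg-distrib-+; neg-distribˡ-*)
open import Data.Integer.Tactic.RingSolver using (solve-∀)
open import Data.List using (List; []; _∷_; _++_; map; foldr; length)
open import Data.List.Properties using (map-++; map-∘; map-cong)
open import Data.List.Relation.Unary.AllPairs using (AllPairs)
open import Data.Nat as ℕ using (ℕ; zero; suc; _≤_; _^_)
open import Data.Nat.Coprimality using (Coprime; coprime-divisor)
open import Data.Nat.Divisibility using (_∣_; _∣?_; ∣-refl; ∣-trans; ∣1⇒≡1; m∣m*n)
open import Data.Nat.GCD using (gcd; gcd[m,n]∣m; gcd[m,n]∣n; gcd-greatest)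
open import Data.Nat.Primality using (Prime; prime⇒irreducible; prime⇒nonTrivial)
open import Data.Product using (_×_; _,_; uncurry)
open import Data.Sum using (inj₁; inj₂)
open import Data.Vec using (Vec)
open import Function using (_⇔_; mk⇔)
open import Relation.Binary.PropositionalEquality
  using (_≡_; refl; sym; trans; cong; cong₂; module ≡-Reasoning)
open import Relation.Nullary using (¬_; does; ¬?; contradiction)
open import Relation.Nullary.Decidable using (does-⇔; dec-true; _×-dec_)

open ≡-Reasoning

𝟙 : Bool → ℤ
𝟙 true  = + 1
𝟙 false = + 0

sumℤ : List ℤ → ℤ
sumℤ = foldr _+_ (+ 0)

sumℤ-++ : ∀ xs ys → sumℤ (xs ++ ys) ≡ sumℤ xs + sumℤ ys
sumℤ-++ []       ys = sym (+-identityˡ (sumℤ ys))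
sumℤ-++ (x ∷ xs) ys =
  trans (cong (λ s → x + s) (sumℤ-++ xs ys)) (sym (+-assoc x (sumℤ xs) (sumℤ ys)))

sumℤ-map-neg : ∀ {A : Set} (f : A → ℤ) xs → sumℤ (map (λ y → - f y) xs) ≡ - sumℤ (map f xs)
sumℤ-map-neg f []       = refl
sumℤ-map-neg f (x ∷ xs) =
  trans (cong (λ s → - f x + s) (sumℤ-map-neg f xs)) (sym (neg-distrib-+ (f x) (sumℤ (map f xs))))

module _ {A : Set} where

  -- altSum h is definitionally altSumℤ (λ J → + h J).
  altSumℤ : (List A → ℤ) → List A → ℤ
  altSumℤ h F = sumℤ (map (λ J → signSucc (length J) * h J) (subfamilies F))

  altSumℤ-[] : ∀ h → altSumℤ h [] ≡ - h []
  altSumℤ-[] h = minus-one-times (h [])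
    where
    minus-one-times : ∀ u → - + 1 * u + + 0 ≡ - u
    minus-one-times = solve-∀

  altSumℤ-∷ : ∀ h x xs → altSumℤ h (x ∷ xs) ≡ altSumℤ h xs - altSumℤ (λ J → h (x ∷ J)) xs
  altSumℤ-∷ h x xs = begin
    sumℤ (map term (subs ++ map (x ∷_) subs))
      ≡⟨ cong sumℤ (map-++ term subs (map (x ∷_) subs)) ⟩
    sumℤ (map term subs ++ map term (map (x ∷_) subs))
      ≡⟨ sumℤ-++ (map term subs) _ ⟩
    altSumℤ h xs + sumℤ (map term (map (x ∷_) subs))
      ≡⟨ cong (λ ys → altSumℤ h xs + sumℤ ys) (trans (sym (map-∘ subs)) (map-cong sign-flip subs)) ⟩
    altSumℤ h xs + sumℤ (map (λ J → - term′ J) subs)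
      ≡⟨ cong (λ s → altSumℤ h xs + s) (sumℤ-map-neg term′ subs) ⟩
    altSumℤ h xs - altSumℤ (λ J → h (x ∷ J)) xs ∎
    where
    subs = subfamilies xs
    term : List A → ℤ
    term J = signSucc (length J) * h J
    term′ : List A → ℤ
    term′ J = signSucc (length J) * h (x ∷ J)
    sign-flip : ∀ J → term (x ∷ J) ≡ - term′ J
    sign-flip J = sym (neg-distribˡ-* (signSucc (length J)) (h (x ∷ J)))

  altSumℤ-cong : ∀ {h h′ : List A → ℤ} → (∀ J → h J ≡ h′ J) → ∀ F → altSumℤ h F ≡ altSumℤ h′ F
  altSumℤ-cong h≗h′ F =
    cong sumℤ (map-cong (λ J → cong (signSucc (length J) *_) (h≗h′ J)) (subfamilies F))

  altSumℤ-+ : ∀ h h′ F → altSumℤ (λ J → h J + h′ J) F ≡ altSumℤ h F + altSumℤ h′ F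
  altSumℤ-+ h h′ [] = begin
    altSumℤ (λ J → h J + h′ J) [] ≡⟨ altSumℤ-[] (λ J → h J + h′ J) ⟩
    - (h [] + h′ [])              ≡⟨ neg-distrib-+ (h []) (h′ []) ⟩
    - h [] + - h′ []              ≡⟨ sym (cong₂ _+_ (altSumℤ-[] h) (altSumℤ-[] h′)) ⟩
    altSumℤ h [] + altSumℤ h′ []  ∎
  altSumℤ-+ h h′ (x ∷ xs) = begin
    altSumℤ (λ J → h J + h′ J) (x ∷ xs)
      ≡⟨ altSumℤ-∷ (λ J → h J + h′ J) x xs ⟩
    altSumℤ (λ J → h J + h′ J) xs - altSumℤ (λ J → hₓ J + h′ₓ J) xs
      ≡⟨ cong₂ _-_ (altSumℤ-+ h h′ xs) (altSumℤ-+ hₓ h′ₓ xs) ⟩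
    (altSumℤ h xs + altSumℤ h′ xs) - (altSumℤ hₓ xs + altSumℤ h′ₓ xs)
      ≡⟨ interchange (altSumℤ h xs) (altSumℤ h′ xs) (altSumℤ hₓ xs) (altSumℤ h′ₓ xs) ⟩
    (altSumℤ h xs - altSumℤ hₓ xs) + (altSumℤ h′ xs - altSumℤ h′ₓ xs)
      ≡⟨ sym (cong₂ _+_ (altSumℤ-∷ h x xs) (altSumℤ-∷ h′ x xs)) ⟩
    altSumℤ h (x ∷ xs) + altSumℤ h′ (x ∷ xs) ∎
    where
    hₓ h′ₓ : List A → ℤ
    hₓ  J = h (x ∷ J)
    h′ₓ J = h′ (x ∷ J)
    interchange : ∀ a b c d → (a + b) - (c + d) ≡ (a - c) + (b - d)
    interchange = solve-∀

  altSumℤ-const-∷ : ∀ c x xs → altSumℤ (λ _ → c) (x ∷ xs) ≡ + 0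
  altSumℤ-const-∷ c x xs = trans (altSumℤ-∷ (λ _ → c) x xs) (+-inverseʳ (altSumℤ (λ _ → c) xs))

  altSumℤ-zero : ∀ F → altSumℤ (λ _ → + 0) F ≡ + 0
  altSumℤ-zero []       = refl
  altSumℤ-zero (x ∷ xs) = altSumℤ-const-∷ (+ 0) x xs

  sub-altSumℤ-zero : ∀ s F → s - altSumℤ (λ _ → + 0) F ≡ s
  sub-altSumℤ-zero s F = trans (cong (λ z → s - z) (altSumℤ-zero F)) (+-identityʳ s)

  all⁺ : (A → Bool) → List A → Bool
  all⁺ b []       = false
  all⁺ b (x ∷ xs) = all b (x ∷ xs)

  altSumℤ-any : ∀ b F → altSumℤ (λ J → 𝟙 (any b J)) F ≡ 𝟙 (all⁺ b F)
  altSumℤ-any b []       = refl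
  altSumℤ-any b (x ∷ xs) = trans (altSumℤ-∷ (λ J → 𝟙 (any b J)) x xs) (by-value (b x))
    where
    without-[] : ∀ ys → 𝟙 (all⁺ b ys) - altSumℤ (λ _ → + 1) ys ≡ 𝟙 (all b ys)
    without-[] []       = refl
    without-[] (y ∷ ys) =
      trans (cong (λ s → 𝟙 (all b (y ∷ ys)) - s) (altSumℤ-const-∷ (+ 1) y ys)) (+-identityʳ _)
    by-value : ∀ v → altSumℤ (λ J → 𝟙 (any b J)) xs - altSumℤ (λ J → 𝟙 (v ∨ any b J)) xs
                     ≡ 𝟙 (v ∧ all b xs)
    by-value true  = trans (cong (λ s → s - altSumℤ (λ _ → + 1) xs) (altSumℤ-any b xs)) (without-[] xs)
    by-value false = +-inverseʳ (altSumℤ (λ J → 𝟙 (any b J)) xs)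

  altSumℤ-all : ∀ b F → altSumℤ (λ J → 𝟙 (all b J)) F ≡ 𝟙 (any b F) - + 1
  altSumℤ-all b []       = refl
  altSumℤ-all b (x ∷ xs) = trans (altSumℤ-∷ (λ J → 𝟙 (all b J)) x xs) (by-value (b x))
    where
    by-value : ∀ v → altSumℤ (λ J → 𝟙 (all b J)) xs - altSumℤ (λ J → 𝟙 (v ∧ all b J)) xs
                     ≡ 𝟙 (v ∨ any b xs) - + 1
    by-value true  = +-inverseʳ (altSumℤ (λ J → 𝟙 (all b J)) xs)
    by-value false = trans (sub-altSumℤ-zero _ xs) (altSumℤ-all b xs)

  altSumℤ-all⁺ : ∀ b F → altSumℤ (λ J → 𝟙 (all⁺ b J)) F ≡ 𝟙 (any b F)
  altSumℤ-all⁺ b []       = refl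
  altSumℤ-all⁺ b (x ∷ xs) = trans (altSumℤ-∷ (λ J → 𝟙 (all⁺ b J)) x xs) (by-value (b x))
    where
    cancel : ∀ u → u - (u - + 1) ≡ + 1
    cancel = solve-∀
    by-value : ∀ v → altSumℤ (λ J → 𝟙 (all⁺ b J)) xs - altSumℤ (λ J → 𝟙 (v ∧ all b J)) xs
                     ≡ 𝟙 (v ∨ any b xs)
    by-value true  = trans (cong₂ _-_ (altSumℤ-all⁺ b xs) (altSumℤ-all b xs)) (cancel (𝟙 (any b xs)))
    by-value false = trans (sub-altSumℤ-zero _ xs) (altSumℤ-all⁺ b xs)

module _ {B : Set} where

  countB-∷ : ∀ (P : B → Bool) t ts → + countB P (t ∷ ts) ≡ 𝟙 (P t) + + countB P ts
  countB-∷ P t ts = by-value (P t)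
    where
    by-value : ∀ v → + (if v then suc (countB P ts) else countB P ts) ≡ 𝟙 v + + countB P ts
    by-value true  = refl
    by-value false = refl

  countB-cong : ∀ {P Q : B → Bool} → (∀ t → P t ≡ Q t) → ∀ ts → countB P ts ≡ countB Q ts
  countB-cong P≗Q []       = refl
  countB-cong P≗Q (t ∷ ts) = cong₂ (λ v c → if v then suc c else c) (P≗Q t) (countB-cong P≗Q ts)

  countB-false : ∀ ts → countB (λ (_ : B) → false) ts ≡ 0
  countB-false []       = refl
  countB-false (t ∷ ts) = countB-false ts

  module _ {A : Set} (Q : List A → B → Bool) (R : B → Bool) (F : List A)
           (pointwise : ∀ t → altSumℤ (λ J → 𝟙 (Q J t)) F ≡ 𝟙 (R t)) where

    altSumℤ-countB : ∀ ts → altSumℤ (λ J → + countB (Q J) ts) F ≡ + countB R ts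
    altSumℤ-countB []       = altSumℤ-zero F
    altSumℤ-countB (t ∷ ts) = begin
      altSumℤ (λ J → + countB (Q J) (t ∷ ts)) F
        ≡⟨ altSumℤ-cong (λ J → countB-∷ (Q J) t ts) F ⟩
      altSumℤ (λ J → 𝟙 (Q J t) + + countB (Q J) ts) F
        ≡⟨ altSumℤ-+ (λ J → 𝟙 (Q J t)) (λ J → + countB (Q J) ts) F ⟩
      altSumℤ (λ J → 𝟙 (Q J t)) F + altSumℤ (λ J → + countB (Q J) ts) F
        ≡⟨ cong₂ _+_ (pointwise t) (altSumℤ-countB ts) ⟩
      𝟙 (R t) + + countB R ts
        ≡⟨ sym (countB-∷ R t ts) ⟩
      + countB R (t ∷ ts) ∎

prime∤⇒coprime : ∀ {p d} → Prime p → ¬ p ∣ d → Coprime d p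
prime∤⇒coprime p-prime p∤d (i∣d , i∣p) with prime⇒irreducible p-prime i∣p
... | inj₁ i≡1 = i≡1
... | inj₂ refl = contradiction i∣d p∤d

p∤d∣p^a⇒d≡1 : ∀ {p d} a → Prime p → ¬ p ∣ d → d ∣ p ^ a → d ≡ 1
p∤d∣p^a⇒d≡1 zero    p-prime p∤d d∣1   = ∣1⇒≡1 d∣1
p∤d∣p^a⇒d≡1 (suc a) p-prime p∤d d∣p^a =
  p∤d∣p^a⇒d≡1 a p-prime p∤d (coprime-divisor (prime∤⇒coprime p-prime p∤d) d∣p^a)

p∣p^a : ∀ p a → 1 ≤ a → p ∣ p ^ a
p∣p^a p (suc a) _ = m∣m*n (p ^ a)

∣gcd⇔∣×∣ : ∀ {d m n} → d ∣ gcd m n ⇔ ((d ∣ m) × (d ∣ n))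
∣gcd⇔∣×∣ {m = m} {n} =
  mk⇔ (λ d∣g → ∣-trans d∣g (gcd[m,n]∣m m n) , ∣-trans d∣g (gcd[m,n]∣n m n)) (uncurry gcd-greatest)

gcdAll∣ : ∀ {k} (G : List (Poly k)) x n → gcdAll G x n ∣ n
gcdAll∣ []      x n = ∣-refl
gcdAll∣ (g ∷ G) x n = ∣-trans (gcd[m,n]∣n ∣ ⟦ g ⟧ x ∣ (gcdAll G x n)) (gcdAll∣ G x n)

not-distrib-∧ : ∀ x y → not (x ∧ y) ≡ not x ∨ not y
not-distrib-∧ true  y = refl
not-distrib-∧ false y = refl

module PrimePower {p} (p-prime : Prime p) (a : ℕ) (1≤a : 1 ≤ a) where

  divisor≡1⇔∤ : ∀ {d} → d ∣ p ^ a → (d ≡ 1 ⇔ (¬ p ∣ d))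
  divisor≡1⇔∤ d∣p^a =
    mk⇔ (λ { refl p∣1 → ℕ.nonTrivial⇒≢1 {{prime⇒nonTrivial p-prime}} (∣1⇒≡1 p∣1) })
        (λ p∤d → p∤d∣p^a⇒d≡1 a p-prime p∤d d∣p^a)

  does-≟1 : ∀ {d} → d ∣ p ^ a → does (d ℕ.≟ 1) ≡ not (does (p ∣? d))
  does-≟1 {d} d∣p^a = does-⇔ (divisor≡1⇔∤ d∣p^a) (d ℕ.≟ 1) (¬? (p ∣? d))

  does-∣gcd : ∀ m n → does (p ∣? gcd m n) ≡ does (p ∣? m) ∧ does (p ∣? n)
  does-∣gcd m n = does-⇔ ∣gcd⇔∣×∣ (p ∣? gcd m n) (p ∣? m ×-dec p ∣? n)

  indivisibleAt : ∀ {k} → Vec ℤ k → Poly k → Bool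
  indivisibleAt x g = not (does (p ∣? ∣ ⟦ g ⟧ x ∣))

  gcdAll≡1 : ∀ {k} (G : List (Poly k)) x → does (gcdAll G x (p ^ a) ℕ.≟ 1) ≡ any (indivisibleAt x) G
  gcdAll≡1 []      x = trans (does-≟1 ∣-refl) (cong not (dec-true (p ∣? p ^ a) (p∣p^a p a 1≤a)))
  gcdAll≡1 (g ∷ G) x = begin
    does (gcd m r ℕ.≟ 1)                      ≡⟨ does-≟1 (∣-trans (gcd[m,n]∣n m r) r∣p^a) ⟩
    not (does (p ∣? gcd m r))                 ≡⟨ cong not (does-∣gcd m r) ⟩
    not (does (p ∣? m) ∧ does (p ∣? r))       ≡⟨ not-distrib-∧ (does (p ∣? m)) (does (p ∣? r)) ⟩
    indivisibleAt x g ∨ not (does (p ∣? r))   ≡⟨ cong (indivisibleAt x g ∨_) (sym (does-≟1 r∣p^a)) ⟩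
    indivisibleAt x g ∨ does (r ℕ.≟ 1)        ≡⟨ cong (indivisibleAt x g ∨_) (gcdAll≡1 G x) ⟩
    any (indivisibleAt x) (g ∷ G)             ∎
    where
    m = ∣ ⟦ g ⟧ x ∣
    r = gcdAll G x (p ^ a)
    r∣p^a : r ∣ p ^ a
    r∣p^a = gcdAll∣ G x (p ^ a)

  allCoprime≡all : ∀ {k} (G : List (Poly k)) x → allCoprime G x (p ^ a) ≡ all (indivisibleAt x) G
  allCoprime≡all []      x = refl
  allCoprime≡all (g ∷ G) x =
    cong₂ _∧_ (trans (gcdAll≡1 (g ∷ []) x) (∨-identityʳ _)) (allCoprime≡all G x)

  varphi≡countB : ∀ {k} (J : List (Poly k)) →
    varphi J (p ^ a) ≡ countB (λ t → any (indivisibleAt (toℤVec t)) J) (tuples k (p ^ a))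
  varphi≡countB {k} []      = sym (countB-false (tuples k (p ^ a)))
  varphi≡countB {k} (g ∷ G) = countB-cong (λ t → gcdAll≡1 (g ∷ G) (toℤVec t)) (tuples k (p ^ a))

  phi≡countB : ∀ {k} (J : List (Poly k)) →
    phi J (p ^ a) ≡ countB (λ t → all⁺ (indivisibleAt (toℤVec t)) J) (tuples k (p ^ a))
  phi≡countB {k} []      = sym (countB-false (tuples k (p ^ a)))
  phi≡countB {k} (g ∷ G) = countB-cong (λ t → allCoprime≡all (g ∷ G) (toℤVec t)) (tuples k (p ^ a))

mainTheorem1 : (k : ℕ) → 1 ≤ k → (F : List (Poly k))
    → AllPairs (λ f g → ¬ (∀ (x : Vec ℤ k) → ⟦ f ⟧ x ≡ ⟦ g ⟧ x)) F
    → (p : ℕ) → Prime p → (a : ℕ) → 1 ≤ a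
    → (+ phi F (p ^ a) ≡ altSum (λ J → varphi J (p ^ a)) F)
    × (+ varphi F (p ^ a) ≡ altSum (λ J → phi J (p ^ a)) F)
mainTheorem1 k _ F _ p p-prime a 1≤a = phi-identity , varphi-identity
  where
  open PrimePower p-prime a 1≤a
  points = tuples k (p ^ a)
  indivisible : Vec (Fin (p ^ a)) k → Poly k → Bool
  indivisible t = indivisibleAt (toℤVec t)

  phi-identity : + phi F (p ^ a) ≡ altSum (λ J → varphi J (p ^ a)) F
  phi-identity = begin
    + phi F (p ^ a)
      ≡⟨ cong +_ (phi≡countB F) ⟩
    + countB (λ t → all⁺ (indivisible t) F) points
      ≡⟨ sym (altSumℤ-countB (λ J t → any (indivisible t) J) _ F
                             (λ t → altSumℤ-any (indivisible t) F) points) ⟩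
    altSumℤ (λ J → + countB (λ t → any (indivisible t) J) points) F
      ≡⟨ altSumℤ-cong (λ J → cong +_ (sym (varphi≡countB J))) F ⟩
    altSum (λ J → varphi J (p ^ a)) F ∎

  varphi-identity : + varphi F (p ^ a) ≡ altSum (λ J → phi J (p ^ a)) F
  varphi-identity = begin
    + varphi F (p ^ a)
      ≡⟨ cong +_ (varphi≡countB F) ⟩
    + countB (λ t → any (indivisible t) F) points
      ≡⟨ sym (altSumℤ-countB (λ J t → all⁺ (indivisible t) J) _ F
                             (λ t → altSumℤ-all⁺ (indivisible t) F) points) ⟩
    altSumℤ (λ J → + countB (λ t → all⁺ (indivisible t) J) points) F
      ≡⟨ altSumℤ-cong (λ J → cong +_ (sym (phi≡countB J))) F ⟩
    altSum (λ J → phi J (p ^ a)) F ∎
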